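{- Let $n \ge 3$ be an integer such that there exists an exponential orthomorphism modulo $n$. If $n$ is not squarefree, then $n = 4$.
   Context: For an integer $n \ge 2$, an exponential orthomorphism modulo $n$ is a permutation $\sigma$ of $\{1, \dots, n-1\}$ such that the map $x \mapsto x^{\sigma(x)} \bmod n$ is also a bijection of $\{1, \dots, n-1\}$. -}

module Defs where

open import Data.Nat using (ℕ; suc; _∸_; _^_; _*_; _%_; NonZero)
open import Data.Nat.Divisibility using (_∣_)
open import Data.Nat.Primality using (Prime)
open import Data.Fin using (Fin; toℕ)
open import Data.Product using (Σ; _×_)
open import Function.Bundles using (_↔_; Inverse)
open import Relation.Binary.PropositionalEquality using (_≡_)
open import Relation.Nullary using (¬_)

-- The set {1, ..., n-1} is represented by Fin (n ∸ 1), via i ↦ 1 + toℕ i.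
val : {n : ℕ} → Fin (n ∸ 1) → ℕ
val i = suc (toℕ i)

-- An exponential orthomorphism modulo n: a permutation σ of {1,…,n-1}
-- such that x ↦ x ^ σ(x) mod n is also a bijection of {1,…,n-1},
-- i.e. there is a permutation τ of {1,…,n-1} with τ(x) = x ^ σ(x) mod n.
IsExpOrthomorphism : (n : ℕ) → .{{_ : NonZero n}} → (Fin (n ∸ 1) ↔ Fin (n ∸ 1)) → Set
IsExpOrthomorphism n σ =
  Σ (Fin (n ∸ 1) ↔ Fin (n ∸ 1)) λ τ →
    ∀ (x : Fin (n ∸ 1)) →
      val {n} (Inverse.to τ x) ≡ (val {n} x ^ val {n} (Inverse.to σ x)) % n

HasExpOrthomorphism : (n : ℕ) → .{{_ : NonZero n}} → Set
HasExpOrthomorphism n = Σ (Fin (n ∸ 1) ↔ Fin (n ∸ 1)) λ σ → IsExpOrthomorphism n σ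

Squarefree : ℕ → Set
Squarefree n = ∀ (p : ℕ) → Prime p → ¬ (p * p ∣ n)

module Submission where

-- Let σ be an exponential orthomorphism modulo n with associated
-- permutation τ(x) = x ^ σ(x) mod n, and suppose p² ∣ n for a prime p.
-- If x ^ e mod n is divisible by p and e ≥ 2, then p ∣ x (as p ∣ n and p is
-- prime), hence p² ∣ x ^ e, hence p² ∣ x ^ e mod n (as p² ∣ n).  So whenever
-- τ(x) is divisible by p but not by p², the exponent σ(x) must be 1.
-- Unless n = 4 there are two such values below n, namely p and p·c with
-- c ≥ 2, p ∤ c (c = 2 for odd p, and c = 3 for p = 2, where n ≥ 8).  Their
-- τ-preimages are distinct, yet σ maps both to 1, contradicting injectivity
-- of σ.

open import Defs
open import Data.Nat using (ℕ; _≤_; NonZero)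
open import Relation.Binary.PropositionalEquality using (_≡_)
open import Relation.Nullary using (¬_)

open import Data.Nat using (zero; suc; _+_; _*_; _∸_; _^_; _%_; _<_; z≤n; s≤s; _≟_)
open import Data.Nat.Properties
  using (*-identityʳ; *-assoc; *-monoʳ-<; *-cancelˡ-≡; ≤-trans; <-trans; <-≤-trans; n≤1+n; m≤m+n; ∸-monoˡ-≤; <⇒≢; n≢0⇒n>0)
open import Data.Nat.Divisibility
  using (_∣_; divides; ∣-trans; ∣m⇒∣m*n; m∣m*n; *-pres-∣; *-cancelˡ-∣; ∣n∣m%n⇒∣m; %-presˡ-∣; n∣m⇒m%n≡0; ∣⇒≤; ∣1⇒≡1; _∣0)
open import Data.Nat.Primality using (Prime; euclidsLemma; prime⇒nonZero; ¬prime[0]; ¬prime[1])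
open import Data.Fin using (Fin; toℕ; fromℕ<)
open import Data.Fin.Properties using (toℕ-fromℕ<; toℕ-injective)
open import Data.Product using (Σ; _×_; _,_)
open import Data.Sum using (inj₁; inj₂)
open import Data.Empty using (⊥-elim)
open import Function.Bundles using (_↔_; Inverse; Injection)
open import Function.Properties.Inverse using (↔⇒↣)
open import Relation.Binary.PropositionalEquality using (refl; sym; trans; cong; subst; module ≡-Reasoning)
open ≡-Reasoning
open import Relation.Nullary using (yes; no; contradiction)

open Inverse using (to; from; strictlyInverseˡ)

prime∣pow⇒prime∣base : ∀ {p} → Prime p → ∀ v e → p ∣ v ^ suc e → p ∣ v
prime∣pow⇒prime∣base pp v zero p∣v^1 = subst (_ ∣_) (*-identityʳ v) p∣v^1
prime∣pow⇒prime∣base pp v (suc e) p∣v^2+e with euclidsLemma v (v ^ suc e) pp p∣v^2+e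
... | inj₁ p∣v   = p∣v
... | inj₂ p∣v^e = prime∣pow⇒prime∣base pp v e p∣v^e

residue-of-square : ∀ {p n} .{{_ : NonZero n}} → Prime p → p * p ∣ n →
                    ∀ v k → p ∣ v ^ (2 + k) % n → p * p ∣ v ^ (2 + k) % n
residue-of-square {p} {n} pp p²∣n v k p∣r = %-presˡ-∣ p²∣v^2+k p²∣n
  where
  p∣n : p ∣ n
  p∣n = ∣-trans (m∣m*n p) p²∣n
  p∣v : p ∣ v
  p∣v = prime∣pow⇒prime∣base pp v (suc k) (∣n∣m%n⇒∣m p∣n p∣r)
  p²∣v^2+k : p * p ∣ v ^ (2 + k)
  p²∣v^2+k = subst (p * p ∣_) (*-assoc v v (v ^ k)) (∣m⇒∣m*n (v ^ k) (*-pres-∣ p∣v p∣v))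

p²∤p*c : ∀ {p c} → Prime p → ¬ p ∣ c → ¬ p * p ∣ p * c
p²∤p*c {p} pp p∤c p²∣pc = p∤c (*-cancelˡ-∣ p p²∣pc)
  where instance _ = prime⇒nonZero pp

-- If p² ∣ n ≠ 4, there is a multiple p·c < n of p, other than p itself, with
-- p ∤ c: take c = 3 when p = 2 (then 8 ≤ n), and c = 2 when p is odd.
second-exact-multiple : ∀ {p n} .{{_ : NonZero n}} → Prime p → p * p ∣ n → ¬ n ≡ 4 →
                        Σ ℕ λ c → 2 ≤ c × ¬ p ∣ c × p * c < n
second-exact-multiple {2} {n} pp 4∣n n≢4 = 3 , s≤s (s≤s z≤n) , 2∤3 , 6<n 4∣n
  where
  2∤3 : ¬ 2 ∣ 3
  2∤3 2∣3 with n∣m⇒m%n≡0 3 2 2∣3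
  ... | ()
  6<n : 4 ∣ n → 6 < n
  6<n (divides zero n≡0) = contradiction (subst (4 ≤_) n≡0 (∣⇒≤ 4∣n)) λ ()
  6<n (divides 1 n≡4) = contradiction n≡4 n≢4
  6<n (divides (suc (suc q)) n≡8+4q) =
    subst (6 <_) (sym n≡8+4q) (≤-trans (n≤1+n 7) (m≤m+n 8 (q * 4)))
second-exact-multiple {suc (suc (suc k))} {n} pp p²∣n _ = 2 , s≤s (s≤s z≤n) , p∤2 , 2p<n
  where
  p : ℕ
  p = 3 + k
  p∤2 : ¬ p ∣ 2
  p∤2 p∣2 with ∣⇒≤ p∣2
  ... | s≤s (s≤s ())
  2p<n : p * 2 < n
  2p<n = <-≤-trans (*-monoʳ-< p (s≤s (s≤s (s≤s z≤n)))) (∣⇒≤ p²∣n)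
second-exact-multiple {0} pp = ⊥-elim (¬prime[0] pp)
second-exact-multiple {1} pp = ⊥-elim (¬prime[1] pp)

module _ {n : ℕ} .{{_ : NonZero n}} where

  ExponentialPair : (σ τ : Fin (n ∸ 1) ↔ Fin (n ∸ 1)) → Set
  ExponentialPair σ τ = ∀ x → val {n} (to τ x) ≡ (val {n} x ^ val {n} (to σ x)) % n

  attained : (π : Fin (n ∸ 1) ↔ Fin (n ∸ 1)) → ∀ w → 0 < w → w < n →
             Σ (Fin (n ∸ 1)) λ x → val {n} (to π x) ≡ w
  attained π (suc c) _ w<n = from π y , trans (cong (val {n}) (strictlyInverseˡ π y)) (cong suc (toℕ-fromℕ< c<n-1))
    where
    c<n-1 : c < n ∸ 1
    c<n-1 = ∸-monoˡ-≤ 1 w<n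
    y : Fin (n ∸ 1)
    y = fromℕ< c<n-1

  -- A permutation takes the value 1 (index 0) at most once.
  value-one-unique : (σ : Fin (n ∸ 1) ↔ Fin (n ∸ 1)) → ∀ a b →
                     toℕ (to σ a) ≡ 0 → toℕ (to σ b) ≡ 0 → a ≡ b
  value-one-unique σ a b σa≡1 σb≡1 =
    Injection.injective (↔⇒↣ σ) (toℕ-injective (trans σa≡1 (sym σb≡1)))

  exponent-one : (σ τ : Fin (n ∸ 1) ↔ Fin (n ∸ 1)) → ExponentialPair σ τ →
                 ∀ {p} → Prime p → p * p ∣ n →
                 ∀ x → p ∣ val {n} (to τ x) → ¬ p * p ∣ val {n} (to τ x) → toℕ (to σ x) ≡ 0
  exponent-one σ τ orth {p} pp p²∣n x p∣τx p²∤τx with toℕ (to σ x) | orth x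
  ... | zero  | _    = refl
  ... | suc k | τx≡r = contradiction
    (subst (p * p ∣_) (sym τx≡r) (residue-of-square pp p²∣n (val {n} x) k (subst (p ∣_) τx≡r p∣τx)))
    p²∤τx

  exact-multiple-preimage : (σ τ : Fin (n ∸ 1) ↔ Fin (n ∸ 1)) → ExponentialPair σ τ →
                            ∀ {p} → Prime p → p * p ∣ n → ∀ d → ¬ p ∣ d → p * d < n →
                            Σ (Fin (n ∸ 1)) λ x → toℕ (to σ x) ≡ 0 × val {n} (to τ x) ≡ p * d
  exact-multiple-preimage σ τ orth {p} pp p²∣n d p∤d pd<n with attained τ (p * d) (n≢0⇒n>0 pd≢0) pd<n
    where
    pd≢0 : ¬ p * d ≡ 0
    pd≢0 pd≡0 = p²∤p*c pp p∤d (subst (p * p ∣_) (sym pd≡0) ((p * p) ∣0))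
  ... | x , τx≡pd = x , exponent-one σ τ orth pp p²∣n x p∣τx p²∤τx , τx≡pd
    where
    p∣τx : p ∣ val {n} (to τ x)
    p∣τx = subst (p ∣_) (sym τx≡pd) (m∣m*n d)
    p²∤τx : ¬ p * p ∣ val {n} (to τ x)
    p²∤τx = subst (λ w → ¬ p * p ∣ w) (sym τx≡pd) (p²∤p*c pp p∤d)

proposition3p1 : (n : ℕ) → .{{_ : NonZero n}} → 3 ≤ n → HasExpOrthomorphism n → ¬ Squarefree n → n ≡ 4
proposition3p1 n _ (σ , τ , orth) not-squarefree with n ≟ 4
... | yes n≡4 = n≡4
... | no n≢4  = contradiction squarefree not-squarefree
  where
  squarefree : Squarefree n
  squarefree p pp p²∣n with second-exact-multiple pp p²∣n n≢4
  ... | c , 2≤c , p∤c , pc<n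
    with exact-multiple-preimage σ τ orth pp p²∣n 1 p∤1 (<-trans (*-monoʳ-< p 2≤c) pc<n)
       | exact-multiple-preimage σ τ orth pp p²∣n c p∤c pc<n
    where
    instance _ = prime⇒nonZero pp
    p∤1 : ¬ p ∣ 1
    p∤1 p∣1 = ¬prime[1] (subst Prime (∣1⇒≡1 p∣1) pp)
  ... | x₁ , σx₁≡1 , τx₁≡p | x₂ , σx₂≡1 , τx₂≡pc = <⇒≢ 2≤c (*-cancelˡ-≡ 1 c p p≡pc)
    where
    instance _ = prime⇒nonZero pp
    p≡pc : p * 1 ≡ p * c
    p≡pc = begin
      p * 1              ≡⟨ sym τx₁≡p ⟩
      val {n} (to τ x₁)  ≡⟨ cong (λ x → val {n} (to τ x)) (value-one-unique σ x₁ x₂ σx₁≡1 σx₂≡1) ⟩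
      val {n} (to τ x₂)  ≡⟨ τx₂≡pc ⟩
      p * c              ∎
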